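{- Let $n\ge1$, $S\subseteq\mathbb{Z}_n\setminus\{0\}$, and suppose $\mathrm{Circ}(n,S)$ is connected. Then $\mathrm{Circ}(n,S)$ is normal-arc-transitive if and only if $\langle S\rangle=\mathbb{Z}_n$ and $\mathrm{Aut}(\mathbb{Z}_n,S)$ acts regularly on $S$.
   Context: $\mathrm{Circ}(n,S)$ is the digraph on $\mathbb{Z}_n$ with an arc $v\to w$ iff $w-v\in S$; it is connected iff its underlying undirected graph is connected. $\mathrm{Aut}(\mathbb{Z}_n,S)=\{\sigma\in\mathrm{Aut}(\mathbb{Z}_n):\sigma(S)=S\}$, and $\mathrm{Circ}(n,S)$ is normal-arc-transitive if $\mathrm{Aut}(\mathbb{Z}_n,S)$ is transitive on $S$. A group acts regularly on a set if it acts transitively with trivial point stabilisers. -}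

module Defs where

open import Data.Nat using (ℕ; NonZero; _∸_) renaming (_+_ to _+ℕ_)
open import Data.Nat.DivMod using (_%_; m%n<n)
open import Data.Fin using (Fin; toℕ; fromℕ<)
open import Data.Fin.Subset using (Subset; _∈_)
open import Data.Product using (Σ; _×_; _,_)
open import Data.Sum using (_⊎_)
open import Relation.Binary.PropositionalEquality using (_≡_)
open import Relation.Binary.Construct.Closure.ReflexiveTransitive using (Star)
open import Function.Definitions using (Bijective)
open import Function.Bundles using (_⇔_)

module _ {n : ℕ} .{{_ : NonZero n}} where

  0ₙ : Fin n
  0ₙ = fromℕ< (m%n<n 0 n)

  infixl 6 _⊕_
  _⊕_ : Fin n → Fin n → Fin n
  x ⊕ y = fromℕ< (m%n<n (toℕ x +ℕ toℕ y) n)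

  ⊖_ : Fin n → Fin n
  ⊖ x = fromℕ< (m%n<n (n ∸ toℕ x) n)

  Arc : Subset n → Fin n → Fin n → Set
  Arc S v w = Σ (Fin n) λ s → s ∈ S × w ≡ v ⊕ s

  Edge : Subset n → Fin n → Fin n → Set
  Edge S v w = Arc S v w ⊎ Arc S w v

  -- Circ(n,S) is connected iff its underlying undirected graph is connected.
  Connected : Subset n → Set
  Connected S = ∀ v w → Star (Edge S) v w

  data ⟨_⟩ (S : Subset n) : Fin n → Set where
    gen-0   : ⟨ S ⟩ 0ₙ
    gen-∈   : ∀ {s} → s ∈ S → ⟨ S ⟩ s
    gen-⊕   : ∀ {x y} → ⟨ S ⟩ x → ⟨ S ⟩ y → ⟨ S ⟩ (x ⊕ y)
    gen-⊖   : ∀ {x} → ⟨ S ⟩ x → ⟨ S ⟩ (⊖ x)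

  GeneratesAll : Subset n → Set
  GeneratesAll S = ∀ x → ⟨ S ⟩ x

  IsAut : (Fin n → Fin n) → Set
  IsAut σ = Bijective _≡_ _≡_ σ × (∀ x y → σ (x ⊕ y) ≡ σ x ⊕ σ y)

  Preserves : (Fin n → Fin n) → Subset n → Set
  Preserves σ S = ∀ y → (y ∈ S) ⇔ (Σ (Fin n) λ x → x ∈ S × σ x ≡ y)

  IsAutS : Subset n → (Fin n → Fin n) → Set
  IsAutS S σ = IsAut σ × Preserves σ S

  TransitiveOnS : Subset n → Set
  TransitiveOnS S = ∀ s t → s ∈ S → t ∈ S →
    Σ (Fin n → Fin n) λ σ → IsAutS S σ × σ s ≡ t

  TrivialStabilisers : Subset n → Set
  TrivialStabilisers S = ∀ σ s → IsAutS S σ → s ∈ S → σ s ≡ s → ∀ x → σ x ≡ x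

  RegularOnS : Subset n → Set
  RegularOnS S = TransitiveOnS S × TrivialStabilisers S

  NormalArcTransitive : Subset n → Set
  NormalArcTransitive S = TransitiveOnS S

-- Aut(ℤ_n) is abelian: an endomorphism σ of ℤ_n is multiplication by σ(1), so any two commute.
-- If Aut(ℤ_n,S) is transitive on S and σ fixes s ∈ S, then every t = τ s ∈ S is fixed too,
-- since σ (τ s) = τ (σ s) = τ s. A homomorphism fixing S pointwise fixes both endpoints of an
-- edge as soon as it fixes one, so by connectedness it fixes every vertex; the same propagation
-- from 0 along edges gives ⟨S⟩ = ℤ_n.
module Submission where

open import Defs
open import Data.Nat using (ℕ; NonZero; zero; suc; _+_; _*_; _∸_; _%_)
open import Data.Nat.Properties
  using (+-comm; +-assoc; *-identityʳ; <⇒≤; m+[n∸m]≡n; *-commutativeSemigroup)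
open import Data.Nat.DivMod using (m%n<n; %-distribˡ-+; %-distribˡ-*; m%n%n≡m%n; m<n⇒m%n≡m; [m+n]%n≡m%n)
open import Data.Fin using (Fin; toℕ; fromℕ<)
open import Data.Fin.Properties using (toℕ-fromℕ<; toℕ-injective; toℕ<n)
open import Data.Fin.Subset using (Subset; _∈_)
open import Data.Product using (_×_; _,_; proj₁; proj₂)
open import Data.Sum using (inj₁; inj₂)
open import Relation.Nullary using (¬_)
open import Function.Bundles using (_⇔_; mk⇔)
open import Relation.Binary.PropositionalEquality
open import Relation.Binary.Construct.Closure.ReflexiveTransitive using (Star; ε; _◅_)
open import Algebra.Properties.CommutativeSemigroup *-commutativeSemigroup using (x∙yz≈y∙xz)

open ≡-Reasoning

[m%d+n]%d≡[m+n]%d : ∀ m n d .{{_ : NonZero d}} → (m % d + n) % d ≡ (m + n) % d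
[m%d+n]%d≡[m+n]%d m n d = begin
  (m % d + n) % d            ≡⟨ %-distribˡ-+ (m % d) n d ⟩
  (m % d % d + n % d) % d    ≡⟨ cong (λ k → (k + n % d) % d) (m%n%n≡m%n m d) ⟩
  (m % d + n % d) % d        ≡⟨ %-distribˡ-+ m n d ⟨
  (m + n) % d                ∎

[m+n%d]%d≡[m+n]%d : ∀ m n d .{{_ : NonZero d}} → (m + n % d) % d ≡ (m + n) % d
[m+n%d]%d≡[m+n]%d m n d = begin
  (m + n % d) % d  ≡⟨ cong (_% d) (+-comm m (n % d)) ⟩
  (n % d + m) % d  ≡⟨ [m%d+n]%d≡[m+n]%d n m d ⟩
  (n + m) % d      ≡⟨ cong (_% d) (+-comm n m) ⟩
  (m + n) % d      ∎

[m*n%d]%d≡[m*n]%d : ∀ m n d .{{_ : NonZero d}} → (m * (n % d)) % d ≡ (m * n) % d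
[m*n%d]%d≡[m*n]%d m n d = begin
  (m * (n % d)) % d          ≡⟨ %-distribˡ-* m (n % d) d ⟩
  (m % d * (n % d % d)) % d  ≡⟨ cong (λ k → (m % d * k) % d) (m%n%n≡m%n n d) ⟩
  (m % d * (n % d)) % d      ≡⟨ %-distribˡ-* m n d ⟨
  (m * n) % d                ∎

module _ {n : ℕ} .{{_ : NonZero n}} where

  1ₙ : Fin n
  1ₙ = fromℕ< (m%n<n 1 n)

  toℕ%n≡toℕ : ∀ (x : Fin n) → toℕ x % n ≡ toℕ x
  toℕ%n≡toℕ x = m<n⇒m%n≡m (toℕ<n x)

  toℕ-⊕ : ∀ (x y : Fin n) → toℕ (x ⊕ y) ≡ (toℕ x + toℕ y) % n
  toℕ-⊕ x y = toℕ-fromℕ< _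

  ⊕-identityˡ : ∀ (x : Fin n) → 0ₙ ⊕ x ≡ x
  ⊕-identityˡ x = toℕ-injective (begin
    toℕ (0ₙ ⊕ x)                   ≡⟨ toℕ-⊕ 0ₙ x ⟩
    (toℕ (0ₙ {n}) + toℕ x) % n     ≡⟨ cong (λ k → (k + toℕ x) % n) (toℕ-fromℕ< _) ⟩
    (0 % n + toℕ x) % n            ≡⟨ [m%d+n]%d≡[m+n]%d 0 (toℕ x) n ⟩
    toℕ x % n                      ≡⟨ toℕ%n≡toℕ x ⟩
    toℕ x                          ∎)

  ⊕-⊖-cancelʳ : ∀ (x s : Fin n) → x ⊕ s ⊕ ⊖ s ≡ x
  ⊕-⊖-cancelʳ x s = toℕ-injective (begin
    toℕ (x ⊕ s ⊕ ⊖ s)                                ≡⟨ toℕ-⊕ (x ⊕ s) (⊖ s) ⟩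
    (toℕ (x ⊕ s) + toℕ (⊖ s)) % n                    ≡⟨ cong₂ (λ a b → (a + b) % n) (toℕ-⊕ x s) (toℕ-fromℕ< _) ⟩
    ((toℕ x + toℕ s) % n + (n ∸ toℕ s) % n) % n      ≡⟨ [m%d+n]%d≡[m+n]%d _ _ n ⟩
    ((toℕ x + toℕ s) + (n ∸ toℕ s) % n) % n          ≡⟨ [m+n%d]%d≡[m+n]%d _ _ n ⟩
    ((toℕ x + toℕ s) + (n ∸ toℕ s)) % n              ≡⟨ cong (_% n) (+-assoc (toℕ x) (toℕ s) _) ⟩
    (toℕ x + (toℕ s + (n ∸ toℕ s))) % n              ≡⟨ cong (λ k → (toℕ x + k) % n) (m+[n∸m]≡n (<⇒≤ (toℕ<n s))) ⟩
    (toℕ x + n) % n                                  ≡⟨ [m+n]%n≡m%n (toℕ x) n ⟩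
    toℕ x % n                                        ≡⟨ toℕ%n≡toℕ x ⟩
    toℕ x                                            ∎)

  ⊕-cancelʳ : ∀ {x y} (s : Fin n) → x ⊕ s ≡ y ⊕ s → x ≡ y
  ⊕-cancelʳ {x} {y} s eq = begin
    x             ≡⟨ ⊕-⊖-cancelʳ x s ⟨
    x ⊕ s ⊕ ⊖ s   ≡⟨ cong (_⊕ ⊖ s) eq ⟩
    y ⊕ s ⊕ ⊖ s   ≡⟨ ⊕-⊖-cancelʳ y s ⟩
    y             ∎

  infixr 7 _·_
  _·_ : ℕ → Fin n → Fin n
  zero  · y = 0ₙ
  suc k · y = y ⊕ k · y

  toℕ-· : ∀ k (y : Fin n) → toℕ (k · y) ≡ (k * toℕ y) % n
  toℕ-· zero    y = toℕ-fromℕ< _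
  toℕ-· (suc k) y = begin
    toℕ (y ⊕ k · y)                   ≡⟨ toℕ-⊕ y (k · y) ⟩
    (toℕ y + toℕ (k · y)) % n         ≡⟨ cong (λ m → (toℕ y + m) % n) (toℕ-· k y) ⟩
    (toℕ y + (k * toℕ y) % n) % n     ≡⟨ [m+n%d]%d≡[m+n]%d (toℕ y) (k * toℕ y) n ⟩
    (suc k * toℕ y) % n               ∎

  toℕ-·-1ₙ : ∀ (x : Fin n) → toℕ x · 1ₙ ≡ x
  toℕ-·-1ₙ x = toℕ-injective (begin
    toℕ (toℕ x · 1ₙ)           ≡⟨ toℕ-· (toℕ x) 1ₙ ⟩
    (toℕ x * toℕ 1ₙ) % n       ≡⟨ cong (λ k → (toℕ x * k) % n) (toℕ-fromℕ< _) ⟩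
    (toℕ x * (1 % n)) % n      ≡⟨ [m*n%d]%d≡[m*n]%d (toℕ x) 1 n ⟩
    (toℕ x * 1) % n            ≡⟨ cong (_% n) (*-identityʳ (toℕ x)) ⟩
    toℕ x % n                  ≡⟨ toℕ%n≡toℕ x ⟩
    toℕ x                      ∎)

  ·-·-comm : ∀ a b (y : Fin n) → a · b · y ≡ b · a · y
  ·-·-comm a b y = toℕ-injective (begin
    toℕ (a · b · y)               ≡⟨ toℕ-· a (b · y) ⟩
    (a * toℕ (b · y)) % n         ≡⟨ cong (λ k → (a * k) % n) (toℕ-· b y) ⟩
    (a * ((b * toℕ y) % n)) % n   ≡⟨ [m*n%d]%d≡[m*n]%d a _ n ⟩
    (a * (b * toℕ y)) % n         ≡⟨ cong (_% n) (x∙yz≈y∙xz a b (toℕ y)) ⟩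
    (b * (a * toℕ y)) % n         ≡⟨ [m*n%d]%d≡[m*n]%d b _ n ⟨
    (b * ((a * toℕ y) % n)) % n   ≡⟨ cong (λ k → (b * k) % n) (toℕ-· a y) ⟨
    (b * toℕ (a · y)) % n         ≡⟨ toℕ-· b (a · y) ⟨
    toℕ (b · a · y)               ∎)

  IsHom : (Fin n → Fin n) → Set
  IsHom σ = ∀ x y → σ (x ⊕ y) ≡ σ x ⊕ σ y

  module _ (σ : Fin n → Fin n) (hom : IsHom σ) where

    hom-0ₙ : σ 0ₙ ≡ 0ₙ
    hom-0ₙ = ⊕-cancelʳ (σ 0ₙ) (begin
      σ 0ₙ ⊕ σ 0ₙ    ≡⟨ hom 0ₙ 0ₙ ⟨
      σ (0ₙ ⊕ 0ₙ)    ≡⟨ cong σ (⊕-identityˡ 0ₙ) ⟩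
      σ 0ₙ           ≡⟨ ⊕-identityˡ (σ 0ₙ) ⟨
      0ₙ ⊕ σ 0ₙ      ∎)

    hom-· : ∀ k y → σ (k · y) ≡ k · σ y
    hom-· zero    y = hom-0ₙ
    hom-· (suc k) y = trans (hom y (k · y)) (cong (σ y ⊕_) (hom-· k y))

    hom≡·σ1ₙ : ∀ x → σ x ≡ toℕ x · σ 1ₙ
    hom≡·σ1ₙ x = trans (cong σ (sym (toℕ-·-1ₙ x))) (hom-· (toℕ x) 1ₙ)

  hom-comm : ∀ σ τ → IsHom σ → IsHom τ → ∀ x → σ (τ x) ≡ τ (σ x)
  hom-comm σ τ σ-hom τ-hom x = begin
    σ (τ x)              ≡⟨ cong σ (hom≡·σ1ₙ τ τ-hom x) ⟩
    σ (toℕ x · τ 1ₙ)     ≡⟨ hom-· σ σ-hom (toℕ x) (τ 1ₙ) ⟩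
    toℕ x · σ (τ 1ₙ)     ≡⟨ cong (toℕ x ·_) σ∘τ-1ₙ ⟩
    toℕ x · τ (σ 1ₙ)     ≡⟨ hom-· τ τ-hom (toℕ x) (σ 1ₙ) ⟨
    τ (toℕ x · σ 1ₙ)     ≡⟨ cong τ (hom≡·σ1ₙ σ σ-hom x) ⟨
    τ (σ x)              ∎
    where
    a = toℕ (τ 1ₙ)
    b = toℕ (σ 1ₙ)
    σ∘τ-1ₙ : σ (τ 1ₙ) ≡ τ (σ 1ₙ)
    σ∘τ-1ₙ = begin
      σ (τ 1ₙ)       ≡⟨ hom≡·σ1ₙ σ σ-hom (τ 1ₙ) ⟩
      a · σ 1ₙ       ≡⟨ cong (a ·_) (toℕ-·-1ₙ (σ 1ₙ)) ⟨
      a · b · 1ₙ     ≡⟨ ·-·-comm a b 1ₙ ⟩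
      b · a · 1ₙ     ≡⟨ cong (b ·_) (toℕ-·-1ₙ (τ 1ₙ)) ⟩
      b · τ 1ₙ       ≡⟨ hom≡·σ1ₙ τ τ-hom (σ 1ₙ) ⟨
      τ (σ 1ₙ)       ∎

  module _ {S : Subset n} (P : Fin n → Set)
           (P-⊕ : ∀ {x s} → s ∈ S → P x → P (x ⊕ s))
           (P-⊕⁻¹ : ∀ {x s} → s ∈ S → P (x ⊕ s) → P x) where

    star-preserves : ∀ {v w} → Star (Edge S) v w → P v → P w
    star-preserves ε                             p = p
    star-preserves (inj₁ (s , s∈S , refl) ◅ vw) p = star-preserves vw (P-⊕ s∈S p)
    star-preserves (inj₂ (s , s∈S , refl) ◅ vw) p = star-preserves vw (P-⊕⁻¹ s∈S p)

    connected⇒universal : Connected S → P 0ₙ → ∀ x → P x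
    connected⇒universal conn p x = star-preserves (conn 0ₙ x) p

  connected⇒generatesAll : ∀ {S} → Connected S → GeneratesAll S
  connected⇒generatesAll {S} conn = connected⇒universal ⟨ S ⟩
    (λ s∈S g → gen-⊕ g (gen-∈ s∈S))
    (λ {x} {s} s∈S g → subst ⟨ S ⟩ (⊕-⊖-cancelʳ x s) (gen-⊕ g (gen-⊖ (gen-∈ s∈S))))
    conn gen-0

  connected⇒hom-fixing-S≡id : ∀ {S σ} → Connected S → IsHom σ →
    (∀ s → s ∈ S → σ s ≡ s) → ∀ x → σ x ≡ x
  connected⇒hom-fixing-S≡id {S} {σ} conn hom fixS = connected⇒universal (λ x → σ x ≡ x)
    (λ {x} {s} s∈S σx≡x → trans (hom x s) (cong₂ _⊕_ σx≡x (fixS s s∈S)))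
    (λ {x} {s} s∈S σ[x⊕s]≡x⊕s → ⊕-cancelʳ s (begin
      σ x ⊕ s      ≡⟨ cong (σ x ⊕_) (fixS s s∈S) ⟨
      σ x ⊕ σ s    ≡⟨ hom x s ⟨
      σ (x ⊕ s)    ≡⟨ σ[x⊕s]≡x⊕s ⟩
      x ⊕ s        ∎))
    conn (hom-0ₙ σ hom)

  transitive⇒stabiliser-fixes-S : ∀ {S σ s} → TransitiveOnS S → IsAutS S σ →
    s ∈ S → σ s ≡ s → ∀ t → t ∈ S → σ t ≡ t
  transitive⇒stabiliser-fixes-S {σ = σ} {s} transitive σ-aut s∈S σs≡s t t∈S
    with τ , τ-aut , τs≡t ← transitive s t s∈S t∈S = begin
      σ t         ≡⟨ cong σ τs≡t ⟨
      σ (τ s)     ≡⟨ hom-comm σ τ (proj₂ (proj₁ σ-aut)) (proj₂ (proj₁ τ-aut)) s ⟩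
      τ (σ s)     ≡⟨ cong τ σs≡s ⟩
      τ s         ≡⟨ τs≡t ⟩
      t           ∎

lemma2p3 : (n : ℕ) .{{_ : NonZero n}} (S : Subset n) → ¬ (0ₙ ∈ S) → Connected S →
    NormalArcTransitive S ⇔ (GeneratesAll S × RegularOnS S)
lemma2p3 n S _ conn = mk⇔ to (λ (_ , transitive , _) → transitive)
  where
  to : NormalArcTransitive S → GeneratesAll S × RegularOnS S
  to transitive = connected⇒generatesAll conn , transitive , trivial-stabilisers
    where
    trivial-stabilisers : TrivialStabilisers S
    trivial-stabilisers σ s σ-aut s∈S σs≡s = connected⇒hom-fixing-S≡id conn (proj₂ (proj₁ σ-aut))
      (transitive⇒stabiliser-fixes-S transitive σ-aut s∈S σs≡s)
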